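{- Let $\mathcal{C}\subseteq\mathbb{F}_q^{k\times m}$ be a code. For all $A\in\mathrm{GL}_k(\mathbb{F}_q)$ and all $1\le u\le k-1$ we have $\rho(\mathcal{C}) \ge \rho(\Pi(\mathcal{C},A,u)) \ge \rho(\mathcal{C}) - u$, where $\rho(\Pi(\mathcal{C},A,u))$ is the covering radius in $\mathbb{F}_q^{(k-u)\times m}$.
   Context: $q$ prime power, $k\le m$ positive integers. Rank distance $d(M,N)=\mathrm{rk}(M-N)$. A code is a non-empty subset of a matrix space $\mathbb{F}_q^{a\times m}$; its covering radius is $\rho(\mathcal{C}) = \min\{i : \forall X\in\mathbb{F}_q^{a\times m}\ \exists M\in\mathcal{C},\ d(X,M)\le i\}$. $A\mathcal{C}=\{AM : M\in\mathcal{C}\}$, $\pi_u:\mathbb{F}_q^{k\times m}\to\mathbb{F}_q^{(k-u)\times m}$ is projection onto the last $k-u$ rows, and the puncturing is $\Pi(\mathcal{C},A,u)=\pi_u(A\mathcal{C})\subseteq\mathbb{F}_q^{(k-u)\times m}$. -}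

module Defs where

open import Level using (Level; _⊔_) renaming (suc to lsuc)
open import Algebra.Bundles using (CommutativeRing)
open import Data.Nat using (ℕ; zero; suc; _≤_) renaming (_+_ to _+ℕ_)
open import Data.Fin using (Fin; zero; suc; _↑ʳ_)
open import Data.Product using (Σ; _×_; _,_)
open import Relation.Nullary using (¬_)
open import Relation.Binary.PropositionalEquality using (_≡_)

record FiniteField c ℓ : Set (lsuc (c ⊔ ℓ)) where
  field
    commutativeRing : CommutativeRing c ℓ
  open CommutativeRing commutativeRing public
  field
    0≉1 : ¬ (0# ≈ 1#)
    inverse : ∀ x → ¬ (x ≈ 0#) → Σ Carrier λ y → x * y ≈ 1#
    size : ℕ
    enum : Fin size → Carrier
    enum-injective : ∀ i j → enum i ≈ enum j → i ≡ j
    enum-surjective : ∀ x → Σ (Fin size) λ i → enum i ≈ x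

module MatrixDefs {c ℓ} (F : FiniteField c ℓ) where
  open FiniteField F using (Carrier; _≈_; _+_; _*_; _-_; 0#; 1#)

  Mat : ℕ → ℕ → Set c
  Mat a m = Fin a → Fin m → Carrier

  ∑ : ∀ {n} → (Fin n → Carrier) → Carrier
  ∑ {zero} f = 0#
  ∑ {suc n} f = f zero + ∑ (λ i → f (suc i))

  _≈ᴹ_ : ∀ {a m} → Mat a m → Mat a m → Set ℓ
  M ≈ᴹ N = ∀ i j → M i j ≈ N i j

  _-ᴹ_ : ∀ {a m} → Mat a m → Mat a m → Mat a m
  (M -ᴹ N) i j = M i j - N i j

  _*ᴹ_ : ∀ {a b m} → Mat a b → Mat b m → Mat a m
  (A *ᴹ B) i j = ∑ (λ t → A i t * B t j)

  Iᴹ : ∀ {k} → Mat k k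
  Iᴹ i j with i Data.Fin.≟ j
  ... | Relation.Nullary.yes _ = 1#
  ... | Relation.Nullary.no _ = 0#

  Invertible : ∀ {k} → Mat k k → Set (c ⊔ ℓ)
  Invertible {k} A = Σ (Mat k k) λ B → ((A *ᴹ B) ≈ᴹ Iᴹ) × ((B *ᴹ A) ≈ᴹ Iᴹ)

  LinIndep : ∀ {r m} → (Fin r → Fin m → Carrier) → Set (c ⊔ ℓ)
  LinIndep {r} {m} v =
    ∀ (coef : Fin r → Carrier) →
    (∀ j → ∑ (λ t → coef t * v t j) ≈ 0#) → ∀ t → coef t ≈ 0#

  RankAtMost : ∀ {a m} → Mat a m → ℕ → Set (c ⊔ ℓ)
  RankAtMost {a} {m} M i =
    ∀ (r : ℕ) (f : Fin r → Fin a) →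
    (∀ x y → f x ≡ f y → x ≡ y) → LinIndep (λ t → M (f t)) → r ≤ i

  Code : ∀ {ℓ'} → ℕ → ℕ → Set (c ⊔ lsuc ℓ')
  Code {ℓ'} a m = Mat a m → Set ℓ'

  Covers : ∀ {ℓ' a m} → Code {ℓ'} a m → ℕ → Set (c ⊔ ℓ ⊔ ℓ')
  Covers {a = a} {m} C i = ∀ (X : Mat a m) → Σ (Mat a m) λ M → C M × RankAtMost (X -ᴹ M) i

  IsCoveringRadius : ∀ {ℓ' a m} → Code {ℓ'} a m → ℕ → Set (c ⊔ ℓ ⊔ ℓ')
  IsCoveringRadius C r = Covers C r × (∀ i → Covers C i → r ≤ i)

  proj : ∀ u {n m} → Mat (u +ℕ n) m → Mat n m
  proj u M i = M (u ↑ʳ i)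

  Puncture : ∀ {ℓ' n m} → (u : ℕ) → Code {ℓ'} (u +ℕ n) m → Mat (u +ℕ n) (u +ℕ n) →
             Code {c ⊔ ℓ ⊔ ℓ'} n m
  Puncture {m = m} u C A X = Σ (Mat _ m) λ M → C M × (X ≈ᴹ proj u (A *ᴹ M))

module Submission where

-- Left
-- multiplication never increases it, since every row of BN lies in the span of
-- the rows of N and the Steinitz exchange lemma bounds independent families
-- inside a span; so rank is invariant under GL_k.  Deleting the first u rows
-- lowers it by at most u and never raises it.  Hence: lifting X to any matrix
-- Y with π_u(Y) = X and covering A⁻¹Y by C puts X within ρ(C) of Π(C,A,u);
-- conversely, covering π_u(AX) in Π(C,A,u) by some π_u(AM) gives
-- rk(X − M) = rk(AX − AM) ≤ ρ(Π(C,A,u)) + u.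

open import Defs
open import Level using (_⊔_)
import Data.Nat as ℕ
open ℕ using (ℕ; zero; suc; z≤n; s≤s; _≤_; _≤?_)
import Data.Nat.Properties as ℕₚ
open import Data.Fin as Fin using (Fin; zero; suc; punchIn; punchOut; _↑ʳ_)
open import Data.Fin.Properties
  using (any?; suc-injective; ↑ʳ-injective; punchIn-injective; punchInᵢ≢i;
         punchOut-injective; punchIn-punchOut)
open import Data.Vec.Functional using (_∷_; _++_; insertAt; removeAt)
open import Data.Vec.Functional.Properties using (insertAt-lookup; insertAt-punchIn; lookup-++ʳ)
open import Data.Product using (Σ; _×_; _,_; proj₁; proj₂)
open import Function using (_∘_)
open import Relation.Nullary using (¬_; yes; no; ¬?)
open import Relation.Nullary.Negation using (contradiction)
open import Relation.Nullary.Decidable using (decidable-stable; ¬¬-excluded-middle)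
open import Relation.Binary.Definitions using (Decidable)
import Relation.Binary.PropositionalEquality as ≡
open ≡ using (_≡_; _≢_)
import Algebra.Properties.Ring as RingProperties
import Algebra.Properties.Semiring.Sum as SemiringSum

module Properties {c ℓ} (F : FiniteField c ℓ) where
  open FiniteField F hiding (zero)
  open MatrixDefs F
  open RingProperties ring using (-‿distribˡ-*; -‿distribʳ-*; -1*x≈-x; +-inverseˡ-unique)
  private module Sum = SemiringSum semiring
  open import Relation.Binary.Reasoning.Setoid setoid

  _≟_ : Decidable _≈_
  x ≟ y with enum-surjective x | enum-surjective y
  ... | i , eᵢ | j , eⱼ with i Fin.≟ j
  ... | yes ≡.refl = yes (trans (sym eᵢ) eⱼ)
  ... | no i≢j = no λ x≈y → i≢j (enum-injective i j (trans eᵢ (trans x≈y (sym eⱼ))))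

  ∑≡sum : ∀ {n} (f : Fin n → Carrier) → ∑ f ≡ Sum.sum f
  ∑≡sum {zero} f = ≡.refl
  ∑≡sum {suc n} f = ≡.cong (f zero +_) (∑≡sum (f ∘ suc))

  ∑-cong : ∀ {n} {f g : Fin n → Carrier} → (∀ i → f i ≈ g i) → ∑ f ≈ ∑ g
  ∑-cong {f = f} {g} f≈g rewrite ∑≡sum f | ∑≡sum g = Sum.sum-cong-≋ f≈g

  ∑-zero : ∀ {n} {f : Fin n → Carrier} → (∀ i → f i ≈ 0#) → ∑ f ≈ 0#
  ∑-zero {n} {f} f≈0 rewrite ∑≡sum f = trans (Sum.sum-cong-≋ f≈0) (Sum.sum-replicate-zero n)

  ∑-distrib-+ : ∀ {n} (f g : Fin n → Carrier) → ∑ (λ i → f i + g i) ≈ ∑ f + ∑ g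
  ∑-distrib-+ f g rewrite ∑≡sum (λ i → f i + g i) | ∑≡sum f | ∑≡sum g = Sum.∑-distrib-+ f g

  ∑-comm : ∀ {n k} (f : Fin n → Fin k → Carrier) → ∑ (λ i → ∑ (f i)) ≈ ∑ (λ j → ∑ (λ i → f i j))
  ∑-comm {zero} {k} f = sym (∑-zero {k} (λ _ → refl))
  ∑-comm {suc n} f = begin
    ∑ (f zero) + ∑ (λ i → ∑ (f (suc i)))         ≈⟨ +-congˡ (∑-comm (f ∘ suc)) ⟩
    ∑ (f zero) + ∑ (λ j → ∑ (λ i → f (suc i) j)) ≈⟨ ∑-distrib-+ (f zero) _ ⟨
    ∑ (λ j → f zero j + ∑ (λ i → f (suc i) j))   ∎

  *-distribˡ-∑ : ∀ {n} x (f : Fin n → Carrier) → x * ∑ f ≈ ∑ (λ i → x * f i)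
  *-distribˡ-∑ x f rewrite ∑≡sum f | ∑≡sum (λ i → x * f i) = Sum.*-distribˡ-sum x f

  *-distribʳ-∑ : ∀ {n} x (f : Fin n → Carrier) → ∑ f * x ≈ ∑ (λ i → f i * x)
  *-distribʳ-∑ x f rewrite ∑≡sum f | ∑≡sum (λ i → f i * x) = Sum.*-distribʳ-sum x f

  -‿distrib-∑ : ∀ {n} (f : Fin n → Carrier) → - ∑ f ≈ ∑ (λ i → - f i)
  -‿distrib-∑ f = begin
    - ∑ f                  ≈⟨ -1*x≈-x (∑ f) ⟨
    - 1# * ∑ f             ≈⟨ *-distribˡ-∑ (- 1#) f ⟩
    ∑ (λ i → - 1# * f i)   ≈⟨ ∑-cong (λ i → -1*x≈-x (f i)) ⟩
    ∑ (λ i → - f i)        ∎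

  ∑-distrib-- : ∀ {n} (f g : Fin n → Carrier) → ∑ (λ i → f i - g i) ≈ ∑ f - ∑ g
  ∑-distrib-- f g = trans (∑-distrib-+ f (λ i → - g i)) (+-congˡ (sym (-‿distrib-∑ g)))

  ∑-remove : ∀ {n} (f : Fin (suc n) → Carrier) i → ∑ f ≈ f i + ∑ (removeAt f i)
  ∑-remove f i rewrite ∑≡sum f | ∑≡sum (removeAt f i) = Sum.sum-remove f

  linComb : ∀ {r m} → (Fin r → Carrier) → Mat r m → Fin m → Carrier
  linComb coef v j = ∑ (λ t → coef t * v t j)

  InSpan : ∀ {a m} → Mat a m → (Fin m → Carrier) → Set (c ⊔ ℓ)
  InSpan {a} w x = Σ (Fin a → Carrier) λ coef → ∀ j → x j ≈ linComb coef w j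

  _⊆Span_ : ∀ {r a m} → Mat r m → Mat a m → Set (c ⊔ ℓ)
  v ⊆Span w = ∀ t → InSpan w (v t)

  linComb-congʳ : ∀ {r m} coef {v v′ : Mat r m} → (∀ t j → v t j ≈ v′ t j) →
                  ∀ j → linComb coef v j ≈ linComb coef v′ j
  linComb-congʳ coef v≈v′ j = ∑-cong (λ t → *-congˡ (v≈v′ t j))

  linComb-assoc : ∀ {r a m} (coef : Fin r → Carrier) (d : Mat r a) (w : Mat a m) j →
                  linComb coef (λ s → linComb (d s) w) j ≈ linComb (linComb coef d) w j
  linComb-assoc coef d w j = begin
    ∑ (λ s → coef s * ∑ (λ t → d s t * w t j))
      ≈⟨ ∑-cong (λ s → *-distribˡ-∑ (coef s) (λ t → d s t * w t j)) ⟩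
    ∑ (λ s → ∑ (λ t → coef s * (d s t * w t j)))
      ≈⟨ ∑-comm (λ s t → coef s * (d s t * w t j)) ⟩
    ∑ (λ t → ∑ (λ s → coef s * (d s t * w t j)))
      ≈⟨ ∑-cong (λ t → ∑-cong (λ s → *-assoc (coef s) (d s t) (w t j))) ⟨
    ∑ (λ t → ∑ (λ s → coef s * d s t * w t j))
      ≈⟨ ∑-cong (λ t → *-distribʳ-∑ (w t j) (λ s → coef s * d s t)) ⟨
    ∑ (λ t → ∑ (λ s → coef s * d s t) * w t j)
      ∎

  *-distribˡ-linComb : ∀ {r m} x (coef : Fin r → Carrier) (v : Mat r m) j →
                       x * linComb coef v j ≈ linComb (λ t → x * coef t) v j
  *-distribˡ-linComb x coef v j =
    trans (*-distribˡ-∑ x (λ t → coef t * v t j)) (∑-cong (λ t → sym (*-assoc x (coef t) (v t j))))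

  linComb-distribˡ-- : ∀ {r m} (coef coef′ : Fin r → Carrier) (v : Mat r m) j →
                       linComb (λ t → coef t - coef′ t) v j ≈ linComb coef v j - linComb coef′ v j
  linComb-distribˡ-- coef coef′ v j = begin
    ∑ (λ t → (coef t - coef′ t) * v t j)
      ≈⟨ ∑-cong (λ t → distribʳ (v t j) (coef t) (- coef′ t)) ⟩
    ∑ (λ t → coef t * v t j + - coef′ t * v t j)
      ≈⟨ ∑-cong (λ t → +-congˡ (-‿distribˡ-* (coef′ t) (v t j))) ⟨
    ∑ (λ t → coef t * v t j - coef′ t * v t j)
      ≈⟨ ∑-distrib-- (λ t → coef t * v t j) (λ t → coef′ t * v t j) ⟩
    linComb coef v j - linComb coef′ v j
      ∎

  linComb-distribʳ-- : ∀ {r m} (coef : Fin r → Carrier) (v v′ : Mat r m) j →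
                       linComb coef (v -ᴹ v′) j ≈ linComb coef v j - linComb coef v′ j
  linComb-distribʳ-- coef v v′ j = begin
    ∑ (λ t → coef t * (v t j - v′ t j))
      ≈⟨ ∑-cong (λ t → distribˡ (coef t) (v t j) (- v′ t j)) ⟩
    ∑ (λ t → coef t * v t j + coef t * - v′ t j)
      ≈⟨ ∑-cong (λ t → +-congˡ (-‿distribʳ-* (coef t) (v′ t j))) ⟨
    ∑ (λ t → coef t * v t j - coef t * v′ t j)
      ≈⟨ ∑-distrib-- (λ t → coef t * v t j) (λ t → coef t * v′ t j) ⟩
    linComb coef v j - linComb coef v′ j
      ∎

  linComb-outer : ∀ {r m} (coef d : Fin r → Carrier) (x : Fin m → Carrier) j →
                  linComb coef (λ t j → d t * x j) j ≈ ∑ (λ t → coef t * d t) * x j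
  linComb-outer coef d x j = trans (∑-cong (λ t → sym (*-assoc (coef t) (d t) (x j))))
                                   (sym (*-distribʳ-∑ (x j) (λ t → coef t * d t)))

  linComb-insertAt : ∀ {r m} (coef : Fin r → Carrier) t y (v : Mat (suc r) m) j →
                     linComb (insertAt coef t y) v j ≈ y * v t j + linComb coef (removeAt v t) j
  linComb-insertAt coef t y v j = begin
    linComb (insertAt coef t y) v j
      ≈⟨ ∑-remove (λ s → insertAt coef t y s * v s j) t ⟩
    insertAt coef t y t * v t j + ∑ (λ s → insertAt coef t y (punchIn t s) * v (punchIn t s) j)
      ≈⟨ +-cong (*-congʳ (reflexive (insertAt-lookup coef t y)))
                (∑-cong (λ s → *-congʳ (reflexive (insertAt-punchIn coef t y s)))) ⟩
    y * v t j + linComb coef (removeAt v t) j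
      ∎

  linComb-tail : ∀ {a m} (coef : Fin (suc a) → Carrier) (w : Mat (suc a) m) → coef zero ≈ 0# →
                 ∀ j → linComb coef w j ≈ linComb (coef ∘ suc) (w ∘ suc) j
  linComb-tail coef w c₀≈0 j = trans (+-congʳ (trans (*-congʳ c₀≈0) (zeroˡ _))) (+-identityˡ _)

  InSpan-trans : ∀ {r a m} {v : Mat r m} {w : Mat a m} {x} → v ⊆Span w → InSpan v x → InSpan w x
  InSpan-trans {w = w} v⊆w (coef , x≈) =
    linComb coef (proj₁ ∘ v⊆w) ,
    λ j → trans (x≈ j) (trans (linComb-congʳ coef (proj₂ ∘ v⊆w) j) (linComb-assoc coef _ w j))

  LinIndep-cong : ∀ {r m} {v v′ : Mat r m} → (∀ t j → v t j ≈ v′ t j) → LinIndep v → LinIndep v′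
  LinIndep-cong v≈v′ ind coef comb≈0 =
    ind coef (λ j → trans (linComb-congʳ coef v≈v′ j) (comb≈0 j))

  LinIndep-insertAt : ∀ {r m} {v : Mat (suc r) m} → LinIndep v → ∀ coef t y →
                      (∀ j → linComb (insertAt coef t y) v j ≈ 0#) → ∀ s → coef s ≈ 0#
  LinIndep-insertAt ind coef t y comb≈0 s =
    trans (sym (reflexive (insertAt-punchIn coef t y s)))
          (ind (insertAt coef t y) comb≈0 (punchIn t s))

  LinIndep-removeAt : ∀ {r m} {v : Mat (suc r) m} → LinIndep v → ∀ t → LinIndep (removeAt v t)
  LinIndep-removeAt {v = v} ind t coef comb≈0 = LinIndep-insertAt {v = v} ind coef t 0# λ j → begin
    linComb (insertAt coef t 0#) v j             ≈⟨ linComb-insertAt coef t 0# v j ⟩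
    0# * v t j + linComb coef (removeAt v t) j   ≈⟨ +-cong (zeroˡ (v t j)) (comb≈0 j) ⟩
    0# + 0#                                      ≈⟨ +-identityˡ 0# ⟩
    0#                                           ∎

  LinIndep-∷ : ∀ {k m} {x : Fin m → Carrier} {u : Mat k m} →
               LinIndep u → ¬ InSpan u x → LinIndep (x ∷ u)
  LinIndep-∷ {x = x} {u} ind x∉span coef comb≈0 = coef≈0
    where
    rest : Fin _ → Carrier
    rest j = linComb (coef ∘ suc) u j

    x∈span : ¬ coef zero ≈ 0# → InSpan u x
    x∈span c₀≉0 with inverse (coef zero) c₀≉0
    ... | y , c₀y≈1 = (λ t → - y * coef (suc t)) , λ j → begin
      x j                     ≈⟨ *-identityˡ (x j) ⟨
      1# * x j                ≈⟨ *-congʳ (trans (*-comm y (coef zero)) c₀y≈1) ⟨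
      y * coef zero * x j     ≈⟨ *-assoc y (coef zero) (x j) ⟩
      y * (coef zero * x j)   ≈⟨ *-congˡ (+-inverseˡ-unique _ _ (comb≈0 j)) ⟩
      y * - rest j            ≈⟨ -‿distribʳ-* y (rest j) ⟨
      - (y * rest j)          ≈⟨ -‿distribˡ-* y (rest j) ⟩
      - y * rest j            ≈⟨ *-distribˡ-linComb (- y) (coef ∘ suc) u j ⟩
      linComb (λ t → - y * coef (suc t)) u j ∎

    c₀≈0 : coef zero ≈ 0#
    c₀≈0 = decidable-stable (coef zero ≟ 0#) (x∉span ∘ x∈span)

    rest≈0 : ∀ j → rest j ≈ 0#
    rest≈0 j = begin
      rest j                        ≈⟨ +-identityˡ (rest j) ⟨
      0# + rest j                   ≈⟨ +-congʳ (trans (*-congʳ c₀≈0) (zeroˡ (x j))) ⟨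
      coef zero * x j + rest j      ≈⟨ comb≈0 j ⟩
      0#                            ∎

    coef≈0 : ∀ t → coef t ≈ 0#
    coef≈0 zero = c₀≈0
    coef≈0 (suc t) = ind (coef ∘ suc) rest≈0 t

  eliminateRow : ∀ {r m} → Mat (suc r) m → Fin (suc r) → (Fin r → Carrier) → Mat r m
  eliminateRow v t k s j = v (punchIn t s) j - k s * v t j

  LinIndep-eliminateRow : ∀ {r m} {v : Mat (suc r) m} → LinIndep v →
                          ∀ t k → LinIndep (eliminateRow v t k)
  LinIndep-eliminateRow {v = v} ind t k coef comb≈0 =
    LinIndep-insertAt {v = v} ind coef t (- κ) λ j → begin
      linComb (insertAt coef t (- κ)) v j
        ≈⟨ linComb-insertAt coef t (- κ) v j ⟩
      - κ * v t j + linComb coef (removeAt v t) j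
        ≈⟨ +-comm (- κ * v t j) (linComb coef (removeAt v t) j) ⟩
      linComb coef (removeAt v t) j + - κ * v t j
        ≈⟨ +-congˡ (-‿distribˡ-* κ (v t j)) ⟨
      linComb coef (removeAt v t) j - κ * v t j
        ≈⟨ +-congˡ (-‿cong (linComb-outer coef k (v t) j)) ⟨
      linComb coef (removeAt v t) j - linComb coef kv j
        ≈⟨ linComb-distribʳ-- coef (removeAt v t) kv j ⟨
      linComb coef (eliminateRow v t k) j
        ≈⟨ comb≈0 j ⟩
      0#
        ∎
    where
    κ : Carrier
    κ = ∑ (λ s → coef s * k s)
    kv : Mat _ _
    kv s j = k s * v t j

  eliminateRow-⊆Span : ∀ {r a m} {v : Mat (suc r) m} {w : Mat (suc a) m} (sp : v ⊆Span w) →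
                       ∀ t y → proj₁ (sp t) zero * y ≈ 1# →
                       eliminateRow v t (λ s → proj₁ (sp (punchIn t s)) zero * y) ⊆Span (w ∘ suc)
  eliminateRow-⊆Span {v = v} {w} sp t y py≈1 s = coef ∘ suc , λ j → begin
    v (punchIn t s) j - k * v t j                 ≈⟨ +-congˡ (-‿cong (*-congˡ (proj₂ (sp t) j))) ⟩
    v (punchIn t s) j - k * linComb p w j         ≈⟨ +-congʳ (proj₂ (sp (punchIn t s)) j) ⟩
    linComb q w j - k * linComb p w j             ≈⟨ +-congˡ (-‿cong (*-distribˡ-linComb k p w j)) ⟩
    linComb q w j - linComb (λ i → k * p i) w j   ≈⟨ linComb-distribˡ-- q (λ i → k * p i) w j ⟨
    linComb coef w j                              ≈⟨ linComb-tail coef w coef₀≈0 j ⟩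
    linComb (coef ∘ suc) (w ∘ suc) j              ∎
    where
    p q : Fin _ → Carrier
    p = proj₁ (sp t)
    q = proj₁ (sp (punchIn t s))
    k : Carrier
    k = q zero * y
    coef : Fin _ → Carrier
    coef i = q i - k * p i
    coef₀≈0 : coef zero ≈ 0#
    coef₀≈0 = begin
      q zero - q zero * y * p zero     ≈⟨ +-congˡ (-‿cong (*-assoc (q zero) y (p zero))) ⟩
      q zero - q zero * (y * p zero)   ≈⟨ +-congˡ (-‿cong (*-congˡ (trans (*-comm y (p zero)) py≈1))) ⟩
      q zero - q zero * 1#             ≈⟨ +-congˡ (-‿cong (*-identityʳ (q zero))) ⟩
      q zero - q zero                  ≈⟨ -‿inverseʳ (q zero) ⟩
      0#                               ∎

  ⊆Span-tail : ∀ {r a m} {v : Mat r m} {w : Mat (suc a) m} (sp : v ⊆Span w) →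
               (∀ t → proj₁ (sp t) zero ≈ 0#) → v ⊆Span (w ∘ suc)
  ⊆Span-tail {w = w} sp w₀-unused t =
    proj₁ (sp t) ∘ suc , λ j → trans (proj₂ (sp t) j) (linComb-tail (proj₁ (sp t)) w (w₀-unused t) j)

  LinIndep⇒≤ : ∀ {r a m} {v : Mat r m} {w : Mat a m} → LinIndep v → v ⊆Span w → r ≤ a
  LinIndep⇒≤ {zero} _ _ = z≤n
  LinIndep⇒≤ {suc r} {zero} {v = v} ind sp = contradiction (sym (ind (λ _ → 1#) comb≈0 zero)) 0≉1
    where
    comb≈0 : ∀ j → linComb (λ _ → 1#) v j ≈ 0#
    comb≈0 j = ∑-zero (λ t → trans (*-congˡ (proj₂ (sp t) j)) (zeroʳ 1#))
  LinIndep⇒≤ {suc r} {suc a} {v = v} {w} ind sp with any? (λ t → ¬? (proj₁ (sp t) zero ≟ 0#))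
  ... | yes (t , p≉0) with inverse (proj₁ (sp t) zero) p≉0
  ...   | y , py≈1 = s≤s (LinIndep⇒≤ (LinIndep-eliminateRow {v = v} ind t _)
                                     (eliminateRow-⊆Span {w = w} sp t y py≈1))
  LinIndep⇒≤ {suc r} {suc a} {v = v} {w} ind sp | no no-pivot =
    ℕₚ.m≤n⇒m≤1+n (LinIndep⇒≤ ind (⊆Span-tail {w = w} sp w₀-unused))
    where
    w₀-unused : ∀ t → proj₁ (sp t) zero ≈ 0#
    w₀-unused t = decidable-stable (proj₁ (sp t) zero ≟ 0#) (no-pivot ∘ (t ,_))

  InSpan-∷ : ∀ {k m} {x y : Fin m → Carrier} {u : Mat k m} → InSpan u y → InSpan (x ∷ u) y
  InSpan-∷ {x = x} (coef , y≈) = (0# ∷ coef) , λ j →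
    trans (y≈ j) (sym (trans (+-congʳ (zeroˡ (x j))) (+-identityˡ _)))

  InSpan-head : ∀ {k m} {x : Fin m → Carrier} {u : Mat k m} → InSpan (x ∷ u) x
  InSpan-head {x = x} {u} = (1# ∷ λ _ → 0#) , λ j →
    sym (trans (+-cong (*-identityˡ (x j)) (∑-zero (λ t → zeroˡ (u t j)))) (+-identityʳ (x j)))

  record Basis {a m} (w : Mat a m) : Set (c ⊔ ℓ) where
    constructor basis
    field
      dim : ℕ
      index : Fin dim → Fin a
      index-injective : ∀ x y → index x ≡ index y → x ≡ y
      independent : LinIndep (w ∘ index)
      spanning : w ⊆Span (w ∘ index)

  Basis-skip : ∀ {a m} {w : Mat (suc a) m} (b : Basis (w ∘ suc)) →
               InSpan (w ∘ suc ∘ Basis.index b) (w zero) → Basis w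
  Basis-skip (basis k g g-inj ind sp) w₀∈span =
    basis k (suc ∘ g) (λ x y → g-inj x y ∘ suc-injective) ind λ where
      zero → w₀∈span
      (suc s) → sp s

  Basis-add : ∀ {a m} {w : Mat (suc a) m} (b : Basis (w ∘ suc)) →
              ¬ InSpan (w ∘ suc ∘ Basis.index b) (w zero) → Basis w
  Basis-add {a} {w = w} (basis k g g-inj ind sp) w₀∉span =
    basis (suc k) index index-injective (LinIndep-∷ ind w₀∉span) λ where
      zero → InSpan-head
      (suc s) → InSpan-∷ (sp s)
    where
    index : Fin (suc k) → Fin (suc a)
    index = zero ∷ suc ∘ g
    index-injective : ∀ x y → index x ≡ index y → x ≡ y
    index-injective zero zero _ = ≡.refl
    index-injective (suc x) (suc y) eq = ≡.cong suc (g-inj x y (suc-injective eq))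

  ¬¬Basis : ∀ {a m} (w : Mat a m) → ¬ ¬ Basis w
  ¬¬Basis {zero} w no-basis = no-basis (basis 0 (λ ()) (λ ()) (λ _ _ ()) (λ ()))
  ¬¬Basis {suc a} w no-basis = ¬¬Basis (w ∘ suc) λ b → ¬¬-excluded-middle λ where
    (yes w₀∈span) → no-basis (Basis-skip b w₀∈span)
    (no w₀∉span) → no-basis (Basis-add b w₀∉span)

  RankAtMost-cong : ∀ {a m} {M N : Mat a m} {i} → M ≈ᴹ N → RankAtMost M i → RankAtMost N i
  RankAtMost-cong M≈N rk r f f-inj ind =
    rk r f f-inj (LinIndep-cong (λ t j → sym (M≈N (f t) j)) ind)

  -- The basis of the rows of N exists only under double negation, which is
  -- harmless because the goal r ≤ i is decidable.
  RankAtMost-*ᴹ : ∀ {k a m} (B : Mat k a) {N : Mat a m} {i} → RankAtMost N i → RankAtMost (B *ᴹ N) i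
  RankAtMost-*ᴹ B {N} {i} rk r f f-inj ind = decidable-stable (r ≤? i) λ r≰i →
    ¬¬Basis N λ (basis k g g-inj g-ind N⊆g) →
      r≰i (ℕₚ.≤-trans (LinIndep⇒≤ ind (λ t → InSpan-trans N⊆g (B (f t) , λ j → refl)))
                      (rk k g g-inj g-ind))

  RankAtMost-proj : ∀ u {n m} {M : Mat (u ℕ.+ n) m} {i} → RankAtMost M i → RankAtMost (proj u M) i
  RankAtMost-proj u rk r f f-inj =
    rk r ((u ↑ʳ_) ∘ f) (λ x y → f-inj x y ∘ ↑ʳ-injective u (f x) (f y))

  rows-avoiding-zero≤ : ∀ {k m r} {M : Mat (suc k) m} {i} → RankAtMost (M ∘ suc) i →
                        (f : Fin r → Fin (suc k)) → (∀ t → zero ≢ f t) →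
                        (∀ x y → f x ≡ f y → x ≡ y) → LinIndep (M ∘ f) → r ≤ i
  rows-avoiding-zero≤ {M = M} rk f f≢0 f-inj ind =
    rk _ g (λ x y → f-inj x y ∘ punchOut-injective (f≢0 x) (f≢0 y)) (LinIndep-cong M∘f≈ ind)
    where
    g : Fin _ → Fin _
    g t = punchOut (f≢0 t)
    M∘f≈ : ∀ t j → M (f t) j ≈ M (suc (g t)) j
    M∘f≈ t j = reflexive (≡.cong (λ x → M x j) (≡.sym (punchIn-punchOut (f≢0 t))))

  RankAtMost-suc : ∀ {k m} {M : Mat (suc k) m} {i} → RankAtMost (M ∘ suc) i → RankAtMost M (suc i)
  RankAtMost-suc rk zero f f-inj ind = z≤n
  RankAtMost-suc {M = M} rk (suc r) f f-inj ind with any? (λ t → zero Fin.≟ f t)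
  ... | no f≢0 = ℕₚ.m≤n⇒m≤1+n (rows-avoiding-zero≤ {M = M} rk f (λ t → f≢0 ∘ (t ,_)) f-inj ind)
  ... | yes (t , 0≡ft) = s≤s (rows-avoiding-zero≤ {M = M} rk (removeAt f t) others≢0 others-inj
                                                   (LinIndep-removeAt {v = M ∘ f} ind t))
    where
    others≢0 : ∀ s → zero ≢ f (punchIn t s)
    others≢0 s 0≡fs = punchInᵢ≢i t s (f-inj _ _ (≡.trans (≡.sym 0≡fs) 0≡ft))
    others-inj : ∀ x y → f (punchIn t x) ≡ f (punchIn t y) → x ≡ y
    others-inj x y = punchIn-injective t x y ∘ f-inj _ _

  RankAtMost-unproj : ∀ u {n m} {M : Mat (u ℕ.+ n) m} {i} →
                      RankAtMost (proj u M) i → RankAtMost M (u ℕ.+ i)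
  RankAtMost-unproj zero rk = rk
  RankAtMost-unproj (suc u) {M = M} rk =
    RankAtMost-suc {M = M} (RankAtMost-unproj u {M = M ∘ suc} rk)

  Iᴹ-diag : ∀ {k} (i : Fin k) → Iᴹ i i ≈ 1#
  Iᴹ-diag i with i Fin.≟ i
  ... | yes _ = refl
  ... | no i≢i = contradiction ≡.refl i≢i

  Iᴹ-offdiag : ∀ {k} {i j : Fin k} → i ≢ j → Iᴹ i j ≈ 0#
  Iᴹ-offdiag {i = i} {j} i≢j with i Fin.≟ j
  ... | yes i≡j = contradiction i≡j i≢j
  ... | no _ = refl

  *ᴹ-identityˡ : ∀ {k m} (Y : Mat k m) → (Iᴹ *ᴹ Y) ≈ᴹ Y
  *ᴹ-identityˡ {zero} Y ()
  *ᴹ-identityˡ {suc k} Y i j = begin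
    ∑ (λ t → Iᴹ i t * Y t j)
      ≈⟨ ∑-remove (λ t → Iᴹ i t * Y t j) i ⟩
    Iᴹ i i * Y i j + ∑ (λ s → Iᴹ i (punchIn i s) * Y (punchIn i s) j)
      ≈⟨ +-cong (*-congʳ (Iᴹ-diag i)) (∑-zero off-diagonal≈0) ⟩
    1# * Y i j + 0#
      ≈⟨ trans (+-identityʳ _) (*-identityˡ _) ⟩
    Y i j
      ∎
    where
    off-diagonal≈0 : ∀ s → Iᴹ i (punchIn i s) * Y (punchIn i s) j ≈ 0#
    off-diagonal≈0 s = trans (*-congʳ (Iᴹ-offdiag (punchInᵢ≢i i s ∘ ≡.sym))) (zeroˡ _)

  *ᴹ-assoc : ∀ {a b d m} (A : Mat a b) (B : Mat b d) (C : Mat d m) →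
             (A *ᴹ (B *ᴹ C)) ≈ᴹ ((A *ᴹ B) *ᴹ C)
  *ᴹ-assoc A B C i = linComb-assoc (A i) B C

  *ᴹ-distribˡ--ᴹ : ∀ {a b m} (A : Mat a b) (X Y : Mat b m) →
                   (A *ᴹ (X -ᴹ Y)) ≈ᴹ ((A *ᴹ X) -ᴹ (A *ᴹ Y))
  *ᴹ-distribˡ--ᴹ A X Y i = linComb-distribʳ-- (A i) X Y

  *ᴹ-cancelˡ : ∀ {k m} {B A : Mat k k} → (B *ᴹ A) ≈ᴹ Iᴹ → (Y : Mat k m) → (B *ᴹ (A *ᴹ Y)) ≈ᴹ Y
  *ᴹ-cancelˡ {B = B} {A} BA≈I Y i j = begin
    (B *ᴹ (A *ᴹ Y)) i j   ≈⟨ *ᴹ-assoc B A Y i j ⟩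
    ((B *ᴹ A) *ᴹ Y) i j   ≈⟨ ∑-cong (λ t → *-congʳ (BA≈I i t)) ⟩
    (Iᴹ *ᴹ Y) i j         ≈⟨ *ᴹ-identityˡ Y i j ⟩
    Y i j                 ∎

  Covers-Puncture : ∀ {ℓ′ u n m} {C : Code {ℓ′} (u ℕ.+ n) m} {A} → Invertible A →
                    ∀ {r} → Covers C r → Covers (Puncture u C A) r
  Covers-Puncture {u = u} {n} {m} {C} {A} (B , AB≈I , _) {r} covers X = shift (covers (B *ᴹ Y))
    where
    Y : Mat (u ℕ.+ n) m
    Y = (λ _ _ → 0#) ++ X

    shift : Σ (Mat (u ℕ.+ n) m) (λ M → C M × RankAtMost ((B *ᴹ Y) -ᴹ M) r) →
            Σ (Mat n m) (λ N → Puncture u C A N × RankAtMost (X -ᴹ N) r)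
    shift (M , M∈C , rk) =
      proj u (A *ᴹ M) , (M , M∈C , λ _ _ → refl) ,
      RankAtMost-cong A[BY-M]≈X-AM
        (RankAtMost-proj u {M = A *ᴹ ((B *ᴹ Y) -ᴹ M)} (RankAtMost-*ᴹ A rk))
      where
      A[BY-M]≈X-AM : proj u (A *ᴹ ((B *ᴹ Y) -ᴹ M)) ≈ᴹ (X -ᴹ proj u (A *ᴹ M))
      A[BY-M]≈X-AM x j = begin
        (A *ᴹ ((B *ᴹ Y) -ᴹ M)) (u ↑ʳ x) j
          ≈⟨ *ᴹ-distribˡ--ᴹ A (B *ᴹ Y) M (u ↑ʳ x) j ⟩
        (A *ᴹ (B *ᴹ Y)) (u ↑ʳ x) j - (A *ᴹ M) (u ↑ʳ x) j
          ≈⟨ +-congʳ (*ᴹ-cancelˡ AB≈I Y (u ↑ʳ x) j) ⟩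
        Y (u ↑ʳ x) j - (A *ᴹ M) (u ↑ʳ x) j
          ≡⟨ ≡.cong (λ row → row j - (A *ᴹ M) (u ↑ʳ x) j) (lookup-++ʳ {m = u} (λ _ _ → 0#) X x) ⟩
        X x j - (A *ᴹ M) (u ↑ʳ x) j
          ∎

  Covers-Puncture⁻ : ∀ {ℓ′ u n m} {C : Code {ℓ′} (u ℕ.+ n) m} {A} → Invertible A →
                     ∀ {r} → Covers (Puncture u C A) r → Covers C (u ℕ.+ r)
  Covers-Puncture⁻ {u = u} {A = A} (B , _ , BA≈I) covers X with covers (proj u (A *ᴹ X))
  ... | N , (M , M∈C , N≈AM) , rk =
    M , M∈C , RankAtMost-cong B[AX-AM]≈X-M
                (RankAtMost-*ᴹ B (RankAtMost-unproj u {M = (A *ᴹ X) -ᴹ (A *ᴹ M)}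
                                   (RankAtMost-cong AX-N≈AX-AM rk)))
    where
    AX-N≈AX-AM : (proj u (A *ᴹ X) -ᴹ N) ≈ᴹ proj u ((A *ᴹ X) -ᴹ (A *ᴹ M))
    AX-N≈AX-AM x j = +-congˡ (-‿cong (N≈AM x j))
    B[AX-AM]≈X-M : (B *ᴹ ((A *ᴹ X) -ᴹ (A *ᴹ M))) ≈ᴹ (X -ᴹ M)
    B[AX-AM]≈X-M i j =
      trans (∑-cong (λ t → *-congˡ (sym (*ᴹ-distribˡ--ᴹ A X M t j)))) (*ᴹ-cancelˡ BA≈I (X -ᴹ M) i j)

open import Data.Nat using (_+_)

proposition3p7 : ∀ {c ℓ ℓ'} (F : FiniteField c ℓ) →
    let open MatrixDefs F in
    ∀ (u n m : ℕ) → 1 ≤ u → 1 ≤ n → u + n ≤ m →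
    (C : Code {ℓ'} (u + n) m) → Σ (Mat (u + n) m) C →
    (A : Mat (u + n) (u + n)) → Invertible A →
    ∀ (r r' : ℕ) → IsCoveringRadius C r → IsCoveringRadius (Puncture u C A) r' →
    (r' ≤ r) × (r ≤ r' + u)
proposition3p7 F u n m _ _ _ C _ A A-invertible r r' (r-covers , r-least) (r'-covers , r'-least) =
  r'-least r (Covers-Puncture A-invertible r-covers) ,
  r-least (r' + u) (≡.subst (Covers C) (ℕₚ.+-comm u r') (Covers-Puncture⁻ A-invertible r'-covers))
  where
  open MatrixDefs F using (Covers)
  open Properties F
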